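{- Let $H$ be a fixed graph without self-loops. Let $G$ be a graph with twin decomposition $\Pi$, let $P'\neq P''\in\Pi$ with $E_G(P',P'')\neq\emptyset$, and suppose $L(P',G)\subseteq\mathrm{span}(L_\Pi(G\setminus E_G(P',P'')))$. Then $G$ is $H$-colorable if and only if $G\setminus E_G(P',P'')$ is $H$-colorable.
   Context: All graphs are finite, simple and undirected. $E_G(X,Y)$ is the set of edges with one endpoint in $X$ and one in $Y$; $G\setminus F$ is $G$ with edge set $F$ removed; $N_G(P)$ is the open neighborhood of $P$. Vertices $u,v$ are twins if $N_G[u]=N_G[v]$; a twin decomposition of $G$ is a partition of $V(G)$ in which two vertices share a part iff they are twins ($\Pi$ is then also a partition of $V(G\setminus E_G(P',P''))$). $G$ is $H$-colorable if there is $f\colon V(G)\to V(H)$ with $\{f(u),f(v)\}\in E(H)$ for all $\{u,v\}\in E(G)$. $\Delta(H)$ is the maximum degree, $\omega$ the clique number, $[n]=\{1,\dots,n\}$. For each vertex $v$ of the graph and $i\in V(H)$ there is a boolean variable $c_{v,i}$; polynomials are over the integers modulo 2. For a graph $G$ and $P\subseteq V(G)$, $L(P,G)$ is: with $d=\Delta(H)$, (Type 1) for each $S=\{s_1,\dots,s_{d+1}\}\subseteq N_G(P)$ and each $X=\{x_1,\dots,x_{d+1}\}\subseteq V(H)$, the constraint $p_{P,S,X}=\sum_{i_1,\dots,i_d\in[d+1]\text{ pairwise distinct}}\prod_{k=1}^d c_{s_{i_k},x_k}\equiv 0$; (Type 2) for each $k\in[d]$, each $S=\{s_1,\dots,s_k\}\subseteq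 N_G(P)$ of size $k$ and each sequence $x_1,\dots,x_k\in V(H)$ such that $\omega(H[\bigcap_{i=1}^k N_H(x_i)])<|P|$, the constraint $\prod_{i=1}^k c_{s_i,x_i}\equiv 0$. For a partition $\Pi$, $L_\Pi(G)=\bigcup_{P\in\Pi}L(P,G)$. For a polynomial $p$, let $\mathrm{coef}(p)$ be its vector of coefficients (mod 2) with respect to a fixed ordering of the monomials; for a set of constraints/polynomials $\mathcal{P}$, $\mathrm{span}(\mathcal{P})$ is the set of 0/1 vectors that are sums modulo 2 of coefficient vectors of elements of $\mathcal{P}$, and $\mathcal{Q}\subseteq\mathrm{span}(\mathcal{P})$ means $\mathrm{coef}(q)\in\mathrm{span}(\mathcal{P})$ for every $q\in\mathcal{Q}$. -}

module Defs where

open import Data.Nat using (ℕ; zero; suc; _<_; _≤_; _⊔_)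
open import Data.Bool using (Bool; true; false; _∧_; _∨_; not; _xor_; if_then_else_)
import Data.Bool as B
open import Data.Fin using (Fin; inject₁)
import Data.Fin as F
open import Data.List using (List; []; _∷_; map; foldr; allFin; concatMap; filter; length)
open import Data.Bool.ListAction using (and; any)
open import Data.Vec using (Vec; []; _∷_; tabulate; lookup; toList)
import Data.Vec.Properties as VP
open import Data.Product using (Σ; _×_; _,_; ∃; proj₁; proj₂)
open import Data.Sum using (_⊎_)
open import Data.List.Relation.Unary.All using (All)
open import Relation.Nullary.Decidable using (⌊_⌋)
open import Relation.Binary.PropositionalEquality using (_≡_; refl; sym; trans; cong)
open import Function.Bundles using (_⇔_)

record Graph (n : ℕ) : Set where
  field
    adj     : Fin n → Fin n → Bool
    adj-sym : ∀ u v → adj u v ≡ adj v u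
    irrefl  : ∀ v → adj v v ≡ false
open Graph public

_==_ : ∀ {n} → Fin n → Fin n → Bool
a == b = ⌊ a F.≟ b ⌋

VSet : ℕ → Set
VSet n = Fin n → Bool

size : ∀ {n} → VSet n → ℕ
size {n} P = length (filter (λ v → P v B.≟ true) (allFin n))

crossing : ∀ {n} → VSet n → VSet n → Fin n → Fin n → Bool
crossing X Y u v = (X u ∧ Y v) ∨ (Y u ∧ X v)

private
  ∨-comm : ∀ a b → a ∨ b ≡ b ∨ a
  ∨-comm false false = refl
  ∨-comm false true  = refl
  ∨-comm true  false = refl
  ∨-comm true  true  = refl
  ∧-comm : ∀ a b → a ∧ b ≡ b ∧ a
  ∧-comm false false = refl
  ∧-comm false true  = refl
  ∧-comm true  false = refl
  ∧-comm true  true  = refl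

  crossing-sym : ∀ {n} (X Y : VSet n) u v → crossing X Y u v ≡ crossing X Y v u
  crossing-sym X Y u v
    rewrite ∧-comm (X u) (Y v) | ∧-comm (Y u) (X v) = ∨-comm (Y v ∧ X u) (X v ∧ Y u)

  irr-lem : ∀ a b → a ≡ false → a ∧ b ≡ false
  irr-lem .false b refl = refl

removeEdges : ∀ {n} → Graph n → VSet n → VSet n → Graph n
removeEdges G X Y = record
  { adj     = λ u v → adj G u v ∧ not (crossing X Y u v)
  ; adj-sym = λ u v → trans (cong (_∧ not (crossing X Y u v)) (adj-sym G u v))
                            (cong (λ z → adj G v u ∧ not z) (crossing-sym X Y u v))
  ; irrefl  = λ v → irr-lem (adj G v v) _ (irrefl G v)
  }

HasCrossingEdge : ∀ {n} → Graph n → VSet n → VSet n → Set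
HasCrossingEdge G X Y = Σ _ λ u → Σ _ λ v → X u ≡ true × Y v ≡ true × adj G u v ≡ true

closedNbr : ∀ {n} → Graph n → Fin n → Fin n → Bool
closedNbr G u w = (u == w) ∨ adj G u w

Twins : ∀ {n} → Graph n → Fin n → Fin n → Set
Twins G u v = ∀ w → closedNbr G u w ≡ closedNbr G v w

-- A partition Π of V(G) into k (nonempty) parts, given by the part label of
-- each vertex; part j is  { v | π v ≡ j }.
part : ∀ {n k} → (Fin n → Fin k) → Fin k → VSet n
part π j v = π v == j

IsPartition : ∀ {n k} → (Fin n → Fin k) → Set
IsPartition {n} {k} π = ∀ (j : Fin k) → Σ (Fin n) λ v → π v ≡ j

IsTwinDecomposition : ∀ {n k} → Graph n → (Fin n → Fin k) → Set
IsTwinDecomposition G π = IsPartition π × (∀ u v → (π u ≡ π v) ⇔ Twins G u v)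

openNbr : ∀ {n} → Graph n → VSet n → VSet n
openNbr {n} G P w = not (P w) ∧ any (λ v → P v ∧ adj G w v) (allFin n)

degree : ∀ {m} → Graph m → Fin m → ℕ
degree H x = size (adj H x)

maxDegree : ∀ {m} → Graph m → ℕ
maxDegree {m} H = foldr _⊔_ 0 (map (degree H) (allFin m))

allVecs : ∀ {A : Set} → List A → (k : ℕ) → List (Vec A k)
allVecs as zero    = [] ∷ []
allVecs as (suc k) = concatMap (λ a → map (a ∷_) (allVecs as k)) as

allBools : List Bool
allBools = false ∷ true ∷ []

allSubsets : (m : ℕ) → List (VSet m)
allSubsets m = map (λ s v → lookup s v) (allVecs allBools m)

isCliqueB : ∀ {m} → Graph m → VSet m → Bool
isCliqueB {m} H C =
  and (map (λ a → and (map (λ b → not (C a ∧ C b ∧ not (a == b)) ∨ adj H a b) (allFin m))) (allFin m))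

subsetB : ∀ {m} → VSet m → VSet m → Bool
subsetB {m} C A = and (map (λ v → not (C v) ∨ A v) (allFin m))

cliqueNumber : ∀ {m} → Graph m → VSet m → ℕ
cliqueNumber {m} H A =
  foldr _⊔_ 0 (map (λ C → if subsetB C A ∧ isCliqueB H C then size C else 0) (allSubsets m))

commonNbrs : ∀ {m k} → Graph m → (Fin k → Fin m) → VSet m
commonNbrs {m} {k} H x y = and (map (λ i → adj H (x i) y) (allFin k))

-- Polynomials over GF(2) in the boolean variables c_{v,i}, v ∈ V(G), i ∈ V(H).

Var : ℕ → ℕ → Set
Var n m = Fin n × Fin m

Term : ℕ → ℕ → Set
Term n m = List (Var n m)

Poly : ℕ → ℕ → Set
Poly n m = List (Term n m)

-- monomials (boolean variables: c² = c, so a monomial is a set of variables)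
Monomial : ℕ → ℕ → Set
Monomial n m = Vec (Vec Bool m) n

toMonomial : ∀ {n m} → Term n m → Monomial n m
toMonomial t = tabulate λ v → tabulate λ i → any (λ vi → (proj₁ vi == v) ∧ (proj₂ vi == i)) t

coef : ∀ {n m} → Poly n m → Monomial n m → Bool
coef p M = foldr _xor_ false (map (λ t → ⌊ VP.≡-dec (VP.≡-dec B._≟_) (toMonomial t) M ⌋) p)

InSpan : ∀ {n m} → (Poly n m → Set) → Poly n m → Set
InSpan {n} {m} 𝒫 q = Σ (List (Poly n m)) λ ps →
  All 𝒫 ps × (∀ M → coef q M ≡ foldr _xor_ false (map (λ p → coef p M) ps))

SubSpan : ∀ {n m} → (Poly n m → Set) → (Poly n m → Set) → Set
SubSpan 𝒬 𝒫 = ∀ q → 𝒬 q → InSpan 𝒫 q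

Injective : ∀ {a b} → (Fin a → Fin b) → Set
Injective f = ∀ x y → f x ≡ f y → x ≡ y

distinctB : ∀ {r k} → Vec (Fin r) k → Bool
distinctB []       = true
distinctB (a ∷ v)  = not (any (a ==_) (toList v)) ∧ distinctB v

-- p_{P,S,X} = Σ_{i_1..i_d ∈ [d+1] pairwise distinct} Π_{k=1}^d c_{s_{i_k}, x_k}
type1Poly : ∀ {n m} d → (Fin (suc d) → Fin n) → (Fin (suc d) → Fin m) → Poly n m
type1Poly {n} {m} d s x =
  map (λ i → toList (tabulate (λ k → s (lookup i k) , x (inject₁ k))))
      (filter (λ i → distinctB i B.≟ true) (allVecs (allFin (suc d)) d))

module _ {m : ℕ} (H : Graph m) where

  data L {n : ℕ} (P : VSet n) (G : Graph n) : Poly n m → Set where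
    type1 : (s : Fin (suc (maxDegree H)) → Fin n) → Injective s →
            (∀ a → openNbr G P (s a) ≡ true) →
            (x : Fin (suc (maxDegree H)) → Fin m) → Injective x →
            L P G (type1Poly (maxDegree H) s x)
    type2 : (k : ℕ) → 1 ≤ k → k ≤ maxDegree H →
            (s : Fin k → Fin n) → Injective s →
            (∀ a → openNbr G P (s a) ≡ true) →
            (x : Fin k → Fin m) →
            cliqueNumber H (commonNbrs H x) < size P →
            L P G (toList (tabulate (λ a → s a , x a)) ∷ [])

  LΠ : ∀ {n k} → (Fin n → Fin k) → Graph n → Poly n m → Set
  LΠ π G q = Σ _ λ j → L (part π j) G q

Colorable : ∀ {n m} → Graph n → Graph m → Set
Colorable {n} {m} G H = Σ (Fin n → Fin m) λ f →
  ∀ u v → adj G u v ≡ true → adj H (f u) (f v) ≡ true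

module Submission where

-- One direction holds because G ∖ E(P′,P″) is a subgraph of G. Conversely, let f be an H-colouring of
-- G′ = G ∖ E(P′,P″) and evaluate polynomials at c_{v,i} = [f v = i]. Every part P of Π is a clique of G′
-- whose vertices all have the same neighbours outside P, and for such a P every constraint of L(P,G′)
-- evaluates to 0: a type-2 constraint because f embeds P as a clique into the common neighbourhood of the
-- colours it names, and p_{P,S,X} by counting modulo 2 inside the neighbourhood of a colour f(v), v ∈ P,
-- which has at most Δ(H) elements. Since the variables are boolean, evaluation only depends on the
-- coefficient vector, so by the span hypothesis the constraints of L(P′,G) evaluate to 0 as well. For the
-- set Y of colours of N_G(P′) this says |Y| ≤ Δ(H) (type 1) and that the common neighbourhood of Y contains
-- a clique of size |P′| (type 2); recolouring P′ injectively into that clique gives an H-colouring of G.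

open import Defs
open import Data.Nat using (ℕ)
open import Data.Fin using (Fin)
open import Relation.Binary.PropositionalEquality using (_≡_)
open import Relation.Nullary using (¬_)
open import Function.Bundles using (_⇔_)
open import Algebra.Bundles using (CommutativeRing)
open import Data.Bool using (Bool; true; false; _∧_; _∨_; not; _xor_; if_then_else_)
open import Data.Bool.ListAction using (and; any)
open import Data.Bool.Properties
  using ( xor-∧-commutativeRing; xor-identityʳ; xor-same; xor-assoc; not-distribʳ-xor; ∧-distribʳ-xor
        ; ∧-distribˡ-xor; ∧-zeroʳ; ∨-zeroʳ; ¬-not; not-¬; not-injective; not-involutive)
import Data.Bool as B
open import Data.Empty using (⊥)
open import Data.Fin using (zero; suc; inject₁; inject≤; punchIn)
import Data.Fin as F
import Data.Fin.Properties as FP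
open import Data.List using (List; []; _∷_; map; foldr; allFin; filter; length; _++_; concat; concatMap)
import Data.List as L
import Data.List.Properties as LP
open import Data.List.Membership.Propositional using (_∈_)
open import Data.List.Membership.Propositional.Properties
  using (∈-allFin; ∈-filter⁺; ∈-filter⁻; ∈-lookup; ∈-map⁺; ∈-concatMap⁺; ∈-∃++)
open import Data.List.Relation.Unary.All as All using (All; []; _∷_)
open import Data.List.Relation.Unary.AllPairs using (_∷_)
open import Data.List.Relation.Unary.Any as Any using (here; there)
open import Data.List.Relation.Unary.Any.Properties using (lookup-index)
open import Data.List.Relation.Unary.Unique.Propositional using (Unique)
import Data.List.Relation.Unary.Unique.Propositional.Properties as UniqueP
open import Data.Nat using (_≤_; _<_; s≤s; _⊔_)
import Data.Nat as N
import Data.Nat.Properties as NP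
open import Data.Product using (Σ; _×_; _,_; proj₁; proj₂)
open import Data.Sum using (inj₁; inj₂)
open import Data.Vec using (Vec; []; _∷_; tabulate; lookup; toList)
import Data.Vec.Properties as VP
open import Data.Vec.Functional using (removeAt; replicate)
open import Function using (_∘_)
open import Function.Bundles using (mk⇔; Equivalence)
open import Relation.Binary.Definitions using (DecidableEquality)
open import Relation.Binary.PropositionalEquality
  using (refl; sym; trans; cong; cong₂; subst; subst₂; _≗_; module ≡-Reasoning)
open import Relation.Nullary using (yes; no; contradiction)
open import Relation.Nullary.Decidable using (⌊_⌋)

open CommutativeRing xor-∧-commutativeRing using (+-commutativeMonoid)
open import Algebra.Properties.CommutativeMonoid.Sum +-commutativeMonoid
  using (sum; sum-syntax; ∑-comm; sum-cong-≗; sum-remove; sum-replicate-zero)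

module _ {A : Set} (_≟_ : DecidableEquality A) {x y : A} where

  ⌊≟⌋⇒≡ : ⌊ x ≟ y ⌋ ≡ true → x ≡ y
  ⌊≟⌋⇒≡ e with x ≟ y
  ... | yes x≡y = x≡y

  ≡⇒⌊≟⌋ : x ≡ y → ⌊ x ≟ y ⌋ ≡ true
  ≡⇒⌊≟⌋ x≡y with x ≟ y
  ... | yes _  = refl
  ... | no x≢y = contradiction x≡y x≢y

  ≢⇒⌊≟⌋ : ¬ x ≡ y → ⌊ x ≟ y ⌋ ≡ false
  ≢⇒⌊≟⌋ x≢y with x ≟ y
  ... | yes x≡y = contradiction x≡y x≢y
  ... | no _    = refl

==⇒≡ : ∀ {n} {a b : Fin n} → (a == b) ≡ true → a ≡ b
==⇒≡ = ⌊≟⌋⇒≡ F._≟_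

≡⇒== : ∀ {n} {a b : Fin n} → a ≡ b → (a == b) ≡ true
≡⇒== = ≡⇒⌊≟⌋ F._≟_

≢⇒== : ∀ {n} {a b : Fin n} → ¬ a ≡ b → (a == b) ≡ false
≢⇒== = ≢⇒⌊≟⌋ F._≟_

∧-true⁺ : ∀ {a b} → a ≡ true → b ≡ true → a ∧ b ≡ true
∧-true⁺ refl refl = refl

∧-true⁻ : ∀ {a b} → a ∧ b ≡ true → a ≡ true × b ≡ true
∧-true⁻ {true} e = refl , e

≡-from-true⇔ : ∀ {a b} → (a ≡ true → b ≡ true) → (b ≡ true → a ≡ true) → a ≡ b
≡-from-true⇔ {true}  a⇒b _ = sym (a⇒b refl)
≡-from-true⇔ {false} {true}  _ b⇒a = b⇒a refl
≡-from-true⇔ {false} {false} _ _   = refl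

any-true⁻ : ∀ {A : Set} (g : A → Bool) xs → any g xs ≡ true → Σ A λ x → x ∈ xs × g x ≡ true
any-true⁻ g (x ∷ xs) e with g x in gx
... | true  = x , here refl , gx
... | false with y , y∈xs , gy ← any-true⁻ g xs e = y , there y∈xs , gy

any-true⁺ : ∀ {A : Set} (g : A → Bool) {xs x} → x ∈ xs → g x ≡ true → any g xs ≡ true
any-true⁺ g (here refl) gx rewrite gx = refl
any-true⁺ g {y ∷ _} (there x∈xs) gx rewrite any-true⁺ g x∈xs gx = ∨-zeroʳ (g y)

and-true⁻ : ∀ {A : Set} (g : A → Bool) {xs x} → and (map g xs) ≡ true → x ∈ xs → g x ≡ true
and-true⁻ g e (here refl) = proj₁ (∧-true⁻ e)
and-true⁻ g {y ∷ _} e (there x∈xs) = and-true⁻ g (proj₂ (∧-true⁻ {g y} e)) x∈xs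

and-true⁺ : ∀ {A : Set} (g : A → Bool) xs → (∀ x → x ∈ xs → g x ≡ true) → and (map g xs) ≡ true
and-true⁺ g []       _ = refl
and-true⁺ g (x ∷ xs) h = ∧-true⁺ (h x (here refl)) (and-true⁺ g xs (λ y → h y ∘ there))

⊕ : List Bool → Bool
⊕ = foldr _xor_ false

⊕-++ : ∀ {A : Set} (g : A → Bool) xs ys → ⊕ (map g (xs ++ ys)) ≡ ⊕ (map g xs) xor ⊕ (map g ys)
⊕-++ g []       ys = refl
⊕-++ g (x ∷ xs) ys = trans (cong (g x xor_) (⊕-++ g xs ys)) (sym (xor-assoc (g x) _ _))

⊕-concat : ∀ {A : Set} (g : A → Bool) xss → ⊕ (map g (concat xss)) ≡ ⊕ (map (λ xs → ⊕ (map g xs)) xss)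
⊕-concat g []         = refl
⊕-concat g (xs ∷ xss) = trans (⊕-++ g xs (concat xss)) (cong (⊕ (map g xs) xor_) (⊕-concat g xss))

⊕-concatMap : ∀ {A B : Set} (g : B → Bool) (F : A → List B) xs →
  ⊕ (map g (concatMap F xs)) ≡ ⊕ (map (λ a → ⊕ (map g (F a))) xs)
⊕-concatMap g F xs = trans (⊕-concat g (map F xs)) (cong ⊕ (sym (LP.map-∘ xs)))

⊕-∧ˡ : ∀ {A : Set} (g : A → Bool) c xs → ⊕ (map (λ a → c ∧ g a) xs) ≡ c ∧ ⊕ (map g xs)
⊕-∧ˡ g c []       = sym (∧-zeroʳ c)
⊕-∧ˡ g c (x ∷ xs) = trans (cong (c ∧ g x xor_) (⊕-∧ˡ g c xs)) (sym (∧-distribˡ-xor c (g x) _))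

⊕-∧ʳ : ∀ {A : Set} (g : A → Bool) c xs → ⊕ (map (λ a → g a ∧ c) xs) ≡ ⊕ (map g xs) ∧ c
⊕-∧ʳ g c []       = refl
⊕-∧ʳ g c (x ∷ xs) = trans (cong (g x ∧ c xor_) (⊕-∧ʳ g c xs)) (sym (∧-distribʳ-xor c (g x) _))

⊕-filter : ∀ {A : Set} (p g : A → Bool) xs →
  ⊕ (map g (filter (λ a → p a B.≟ true) xs)) ≡ ⊕ (map (λ a → p a ∧ g a) xs)
⊕-filter p g [] = refl
⊕-filter p g (x ∷ xs) with p x
... | true  = cong (g x xor_) (⊕-filter p g xs)
... | false = ⊕-filter p g xs

⊕-true⁻ : ∀ {A : Set} (g : A → Bool) xs → ⊕ (map g xs) ≡ true → Σ A λ x → x ∈ xs × g x ≡ true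
⊕-true⁻ g (x ∷ xs) e with g x in gx
... | true  = x , here refl , gx
... | false with y , y∈xs , gy ← ⊕-true⁻ g xs e = y , there y∈xs , gy

⊕-cancel : ∀ {A : Set} (g : A → Bool) {a b} → g a ≡ g b → ∀ us ws →
  ⊕ (map g (a ∷ us ++ b ∷ ws)) ≡ ⊕ (map g (us ++ ws))
⊕-cancel g {a} {b} ga≡gb us ws = begin
  g a xor ⊕ (map g (us ++ b ∷ ws))          ≡⟨ cong (g a xor_) (⊕-++ g us (b ∷ ws)) ⟩
  g a xor (⊕ (map g us) xor (g b xor ⊕ws))  ≡⟨ cong (λ c → g a xor (⊕ (map g us) xor (c xor ⊕ws))) ga≡gb ⟨
  g a xor (⊕ (map g us) xor (g a xor ⊕ws))  ≡⟨ xor-cancel (g a) (⊕ (map g us)) ⊕ws ⟩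
  ⊕ (map g us) xor ⊕ws                      ≡⟨ ⊕-++ g us ws ⟨
  ⊕ (map g (us ++ ws))                      ∎
  where
  open ≡-Reasoning
  ⊕ws = ⊕ (map g ws)
  xor-cancel : ∀ c u w → c xor (u xor (c xor w)) ≡ u xor w
  xor-cancel false u w = refl
  xor-cancel true  u w = trans (not-distribʳ-xor u (not w)) (cong (u xor_) (not-involutive w))

⊕-tabulate : ∀ {A : Set} {r} (h : A → Bool) (g : Fin r → A) → ⊕ (map h (L.tabulate g)) ≡ ∑[ a < r ] h (g a)
⊕-tabulate {r = N.zero}  h g = refl
⊕-tabulate {r = N.suc r} h g = cong (h (g zero) xor_) (⊕-tabulate h (g ∘ suc))

⊕-allFin : ∀ {r} (h : Fin r → Bool) → ⊕ (map h (allFin r)) ≡ ∑[ a < r ] h a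
⊕-allFin h = ⊕-tabulate h (λ a → a)

∑-true⁻ : ∀ {r} (h : Fin r → Bool) → ∑[ a < r ] h a ≡ true → Σ (Fin r) λ a → h a ≡ true
∑-true⁻ {N.suc r} h e with h zero in h0
... | true  = zero , h0
... | false with a , ha ← ∑-true⁻ (h ∘ suc) e = suc a , ha

∑-indicator : ∀ {r} (h : Fin r → Bool) b → h b ≡ true → (∀ a → h a ≡ true → a ≡ b) → ∑[ a < r ] h a ≡ true
∑-indicator {N.suc r} h b hb unique = begin
  sum h                             ≡⟨ sum-remove {i = b} h ⟩
  h b xor sum (removeAt h b)        ≡⟨ cong₂ _xor_ hb (trans (sum-cong-≗ off-b) (sum-replicate-zero r)) ⟩
  true                              ∎
  where
  open ≡-Reasoning
  off-b : removeAt h b ≗ replicate r false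
  off-b a = ¬-not (λ e → FP.punchInᵢ≢i b a (unique (punchIn b a) e))

∏ : ∀ {k} → (Fin k → Bool) → Bool
∏ {N.zero}  h = true
∏ {N.suc k} h = h zero ∧ ∏ (h ∘ suc)

∏-true⁺ : ∀ {k} (h : Fin k → Bool) → (∀ j → h j ≡ true) → ∏ h ≡ true
∏-true⁺ {N.zero}  h _   = refl
∏-true⁺ {N.suc k} h all = ∧-true⁺ (all zero) (∏-true⁺ (h ∘ suc) (all ∘ suc))

∏-true⁻ : ∀ {k} (h : Fin k → Bool) → ∏ h ≡ true → ∀ j → h j ≡ true
∏-true⁻ h e zero    = proj₁ (∧-true⁻ e)
∏-true⁻ h e (suc j) = ∏-true⁻ (h ∘ suc) (proj₂ (∧-true⁻ {h zero} e)) j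

InjectiveOn : ∀ {n m} → VSet n → (Fin n → Fin m) → Set
InjectiveOn P f = ∀ u v → P u ≡ true → P v ≡ true → f u ≡ f v → u ≡ v

lookup-injective : ∀ {A : Set} {xs : List A} → Unique xs → ∀ i j → L.lookup xs i ≡ L.lookup xs j → i ≡ j
lookup-injective (_ ∷ _)   zero    zero    _ = refl
lookup-injective (x∉ ∷ _)  zero    (suc j) e = contradiction e (All.lookup x∉ (∈-lookup j))
lookup-injective (x∉ ∷ _)  (suc i) zero    e = contradiction (sym e) (All.lookup x∉ (∈-lookup i))
lookup-injective (_ ∷ xs!) (suc i) (suc j) e = cong suc (lookup-injective xs! i j e)

module Enumeration {N} (Q : VSet N) where

  private
    members : List (Fin N)
    members = filter (λ v → Q v B.≟ true) (allFin N)

  enum : Fin (size Q) → Fin N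
  enum = L.lookup members

  enum-injective : Injective enum
  enum-injective = lookup-injective (UniqueP.filter⁺ _ (UniqueP.allFin⁺ N))

  enum-∈ : ∀ i → Q (enum i) ≡ true
  enum-∈ i = proj₂ (∈-filter⁻ (λ v → Q v B.≟ true) {xs = allFin N} (∈-lookup i))

  enum-surjective : ∀ v → Q v ≡ true → Σ (Fin (size Q)) λ i → enum i ≡ v
  enum-surjective v Qv = Any.index v∈ , sym (lookup-index v∈)
    where
    v∈ : v ∈ members
    v∈ = ∈-filter⁺ (λ v → Q v B.≟ true) (∈-allFin v) Qv

injection⇒≤size : ∀ {N r} (Q : VSet N) (g : Fin r → Fin N) → Injective g → (∀ i → Q (g i) ≡ true) → r ≤ size Q
injection⇒≤size {r = r} Q g g-inj g∈Q = NP.≮⇒≥ no-collision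
  where
  open Enumeration Q
  index : Fin r → Fin (size Q)
  index i = proj₁ (enum-surjective (g i) (g∈Q i))
  enum-index : ∀ i → enum (index i) ≡ g i
  enum-index i = proj₂ (enum-surjective (g i) (g∈Q i))
  no-collision : ¬ size Q < r
  no-collision size<r with i , j , i<j , same ← FP.pigeonhole size<r index =
    FP.<⇒≢ i<j (g-inj i j (trans (sym (enum-index i)) (trans (cong enum same) (enum-index j))))

nonempty⇒1≤size : ∀ {N} (Q : VSet N) {v} → Q v ≡ true → 1 ≤ size Q
nonempty⇒1≤size Q {v} Qv = injection⇒≤size Q (λ _ → v) (λ { zero zero _ → refl }) (λ _ → Qv)

size-cong : ∀ {N} {Q R : VSet N} → Q ≗ R → size Q ≡ size R
size-cong {N} {Q} {R} Q≗R = cong length (LP.filter-≐ (λ v → Q v B.≟ true) (λ v → R v B.≟ true)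
  ((λ {v} → trans (sym (Q≗R v))) , λ {v} → trans (Q≗R v)) (allFin N))

image : ∀ {n m} → (Fin n → Fin m) → VSet n → VSet m
image {n} f P y = any (λ v → P v ∧ (f v == y)) (allFin n)

image⁺ : ∀ {n m} (f : Fin n → Fin m) (P : VSet n) {v} → P v ≡ true → image f P (f v) ≡ true
image⁺ f P {v} Pv = any-true⁺ (λ u → P u ∧ (f u == f v)) (∈-allFin v) (∧-true⁺ Pv (≡⇒== refl))

image⁻ : ∀ {n m} (f : Fin n → Fin m) (P : VSet n) {y} → image f P y ≡ true → Σ (Fin n) λ v → P v ≡ true × f v ≡ y
image⁻ {n} f P {y} e with v , _ , Pv∧fv≡y ← any-true⁻ (λ v → P v ∧ (f v == y)) (allFin n) e =
  v , proj₁ (∧-true⁻ Pv∧fv≡y) , ==⇒≡ (proj₂ (∧-true⁻ {P v} Pv∧fv≡y))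

≤-size-image : ∀ {n m} (f : Fin n → Fin m) (P : VSet n) → InjectiveOn P f → size P ≤ size (image f P)
≤-size-image f P f-inj = injection⇒≤size (image f P) (f ∘ enum)
  (λ i j e → enum-injective i j (f-inj _ _ (enum-∈ i) (enum-∈ j) e))
  (λ i → image⁺ f P (enum-∈ i))
  where open Enumeration P

≤-maximum : ∀ {A : Set} (g : A → ℕ) {xs x} → x ∈ xs → g x ≤ foldr _⊔_ 0 (map g xs)
≤-maximum g (here refl) = NP.m≤m⊔n _ _
≤-maximum g {y ∷ _} (there x∈xs) = NP.≤-trans (≤-maximum g x∈xs) (NP.m≤n⊔m (g y) _)

maximum-reaches : ∀ {A : Set} (g : A → ℕ) {c} xs → 1 ≤ c → c ≤ foldr _⊔_ 0 (map g xs) → Σ A λ x → x ∈ xs × c ≤ g x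
maximum-reaches g []       1≤c c≤0 = contradiction (NP.≤-trans 1≤c c≤0) (λ ())
maximum-reaches g (x ∷ xs) 1≤c c≤ with NP.⊔-sel (g x) (foldr _⊔_ 0 (map g xs))
... | inj₁ max≡gx = x , here refl , subst (_ ≤_) max≡gx c≤
... | inj₂ max≡rest with y , y∈ , c≤gy ← maximum-reaches g xs 1≤c (subst (_ ≤_) max≡rest c≤) =
  y , there y∈ , c≤gy

degree≤maxDegree : ∀ {m} (H : Graph m) y → degree H y ≤ maxDegree H
degree≤maxDegree H y = ≤-maximum (degree H) (∈-allFin y)

neighbourhood-covered : ∀ {m} (H : Graph m) {y} (x : Fin (maxDegree H) → Fin m) → Injective x →
  (∀ k → adj H y (x k) ≡ true) → ∀ {z} → adj H y z ≡ true → Σ (Fin (maxDegree H)) λ k → z ≡ x k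
neighbourhood-covered H {y} x x-inj yx {z} yz with FP.any? (λ k → z F.≟ x k)
... | yes covered = covered
... | no uncovered =
  contradiction (NP.≤-trans (injection⇒≤size (adj H y) z∷x z∷x-inj z∷x-nbr) (degree≤maxDegree H y)) NP.1+n≰n
  where
  z∷x : Fin (N.suc (maxDegree H)) → Fin _
  z∷x zero    = z
  z∷x (suc k) = x k
  z∷x-inj : Injective z∷x
  z∷x-inj zero    zero     _ = refl
  z∷x-inj zero    (suc k)  e = contradiction (k , e) uncovered
  z∷x-inj (suc k) zero     e = contradiction (k , sym e) uncovered
  z∷x-inj (suc k) (suc k′) e = cong suc (x-inj k k′ e)
  z∷x-nbr : ∀ i → adj H y (z∷x i) ≡ true
  z∷x-nbr zero    = yz
  z∷x-nbr (suc k) = yx k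

IsClique : ∀ {m} → Graph m → VSet m → Set
IsClique H C = ∀ a b → C a ≡ true → C b ≡ true → ¬ a ≡ b → adj H a b ≡ true

_⊆_ : ∀ {m} → VSet m → VSet m → Set
C ⊆ A = ∀ v → C v ≡ true → A v ≡ true

isCliqueB⁺ : ∀ {m} (H : Graph m) (C : VSet m) → IsClique H C → isCliqueB H C ≡ true
isCliqueB⁺ {m} H C clique = and-true⁺ _ (allFin m) λ a _ → and-true⁺ _ (allFin m) λ b _ → pair a b
  where
  pair : ∀ a b → (not (C a ∧ C b ∧ not (a == b)) ∨ adj H a b) ≡ true
  pair a b with C a in Ca | C b in Cb | a F.≟ b
  ... | true  | true  | no a≢b rewrite clique a b Ca Cb a≢b = refl
  ... | true  | true  | yes _  = refl
  ... | true  | false | _      = refl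
  ... | false | _     | _      = refl

isCliqueB⁻ : ∀ {m} (H : Graph m) (C : VSet m) → isCliqueB H C ≡ true → IsClique H C
isCliqueB⁻ H C e a b Ca Cb a≢b
  with and-true⁻ (λ b → not (C a ∧ C b ∧ not (a == b)) ∨ adj H a b) (and-true⁻ _ e (∈-allFin a)) (∈-allFin b)
... | r rewrite Ca | Cb | ≢⇒== a≢b = r

subsetB⁺ : ∀ {m} (C A : VSet m) → C ⊆ A → subsetB C A ≡ true
subsetB⁺ {m} C A C⊆A = and-true⁺ _ (allFin m) λ v _ → member v
  where
  member : ∀ v → (not (C v) ∨ A v) ≡ true
  member v with C v in Cv
  ... | true  = C⊆A v Cv
  ... | false = refl

subsetB⁻ : ∀ {m} (C A : VSet m) → subsetB C A ≡ true → C ⊆ A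
subsetB⁻ C A e v Cv with and-true⁻ (λ v → not (C v) ∨ A v) e (∈-allFin v)
... | r rewrite Cv = r

commonNbrs⁺ : ∀ {m k} (H : Graph m) (x : Fin k → Fin m) {y} → (∀ i → adj H (x i) y ≡ true) → commonNbrs H x y ≡ true
commonNbrs⁺ {k = k} H x h = and-true⁺ _ (allFin k) (λ i _ → h i)

commonNbrs⁻ : ∀ {m k} (H : Graph m) (x : Fin k → Fin m) {y} → commonNbrs H x y ≡ true → ∀ i → adj H (x i) y ≡ true
commonNbrs⁻ H x {y} e i = and-true⁻ (λ i → adj H (x i) y) e (∈-allFin i)

allVecs-complete : ∀ {A : Set} (as : List A) {k} (v : Vec A k) → (∀ j → lookup v j ∈ as) → v ∈ allVecs as k
allVecs-complete as []      _ = here refl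
allVecs-complete as (a ∷ w) h = ∈-concatMap⁺ (λ b → map (b ∷_) (allVecs as _))
  (Any.map (λ { refl → ∈-map⁺ (a ∷_) (allVecs-complete as w (h ∘ suc)) }) (h zero))

∈-allSubsets : ∀ {m} (C : Vec Bool m) → (λ v → lookup C v) ∈ allSubsets m
∈-allSubsets C = ∈-map⁺ (λ s v → lookup s v) (allVecs-complete allBools C (λ j → bool∈ (lookup C j)))
  where
  bool∈ : ∀ b → b ∈ allBools
  bool∈ false = here refl
  bool∈ true  = there (here refl)

clique⇒≤cliqueNumber : ∀ {m} (H : Graph m) {A C : VSet m} → C ⊆ A → IsClique H C → size C ≤ cliqueNumber H A
clique⇒≤cliqueNumber {m} H {A} {C} C⊆A clique = begin
  size C            ≡⟨ size-cong (λ v → sym (C′≗C v)) ⟩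
  size C′           ≡⟨ cong₂ (λ s c → if s ∧ c then size C′ else 0) C′⊆A C′-clique ⟨
  cliqueValue C′    ≤⟨ ≤-maximum cliqueValue (∈-allSubsets (tabulate C)) ⟩
  cliqueNumber H A  ∎
  where
  open NP.≤-Reasoning
  cliqueValue : VSet m → ℕ
  cliqueValue D = if subsetB D A ∧ isCliqueB H D then size D else 0
  C′ : VSet m
  C′ v = lookup (tabulate C) v
  C′≗C : C′ ≗ C
  C′≗C = VP.lookup∘tabulate C
  C′⊆A : subsetB C′ A ≡ true
  C′⊆A = subsetB⁺ C′ A (λ v → C⊆A v ∘ trans (sym (C′≗C v)))
  C′-clique : isCliqueB H C′ ≡ true
  C′-clique = isCliqueB⁺ H C′ λ a b C′a C′b →
    clique a b (trans (sym (C′≗C a)) C′a) (trans (sym (C′≗C b)) C′b)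

cliqueNumber-witness : ∀ {m} (H : Graph m) (A : VSet m) {c} → 1 ≤ c → c ≤ cliqueNumber H A →
  Σ (VSet m) λ C → C ⊆ A × IsClique H C × c ≤ size C
cliqueNumber-witness {m} H A 1≤c c≤ω
  with C , _ , c≤ ← maximum-reaches (λ D → if subsetB D A ∧ isCliqueB H D then size D else 0)
                                     (allSubsets m) 1≤c c≤ω
  with subsetB C A in C⊆A | isCliqueB H C in C-clique
... | true  | true  = C , subsetB⁻ C A C⊆A , isCliqueB⁻ H C C-clique , c≤
... | true  | false = contradiction (NP.≤-trans 1≤c c≤) (λ ())
... | false | _     = contradiction (NP.≤-trans 1≤c c≤) (λ ())

-- Evaluating polynomials at a colouring

module _ {A K : Set} (_≟_ : DecidableEquality K) (key : A → K) where

  multiplicity : List A → K → Bool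
  multiplicity xs k = ⊕ (map (λ a → ⌊ key a ≟ k ⌋) xs)

  partner : ∀ a xs → multiplicity (a ∷ xs) (key a) ≡ false → Σ A λ b → b ∈ xs × key a ≡ key b
  partner a xs even
    with b , b∈xs , kb≡ka ← ⊕-true⁻ (λ b → ⌊ key b ≟ key a ⌋) xs
           (not-injective (trans (cong (_xor multiplicity xs (key a)) (sym (≡⇒⌊≟⌋ _≟_ refl))) even))
    = b , b∈xs , sym (⌊≟⌋⇒≡ _≟_ kb≡ka)

  -- Terms with equal keys cancel in pairs.
  ⊕-evenMultiplicities : (val : A → Bool) → (∀ a b → key a ≡ key b → val a ≡ val b) →
    ∀ xs → (∀ k → multiplicity xs k ≡ false) → ⊕ (map val xs) ≡ false
  ⊕-evenMultiplicities val val-resp xs = go (length xs) xs NP.≤-refl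
    where
    go : ∀ fuel xs → length xs ≤ fuel → (∀ k → multiplicity xs k ≡ false) → ⊕ (map val xs) ≡ false
    go _            []       _         _    = refl
    go (N.suc fuel) (a ∷ xs) (s≤s len) even
      with b , b∈xs , ka≡kb ← partner a xs (even (key a))
      with us , ws , refl ← ∈-∃++ b∈xs =
      trans (⊕-cancel val (val-resp a b ka≡kb) us ws) (go fuel (us ++ ws) shorter even′)
      where
      even′ : ∀ k → multiplicity (us ++ ws) k ≡ false
      even′ k = trans (sym (⊕-cancel (λ a → ⌊ key a ≟ k ⌋) (cong (λ k′ → ⌊ k′ ≟ k ⌋) ka≡kb) us ws)) (even k)
      shorter : length (us ++ ws) ≤ fuel
      shorter = begin
        length (us ++ ws)            ≡⟨ LP.length-++ us ⟩
        length us N.+ length ws      ≤⟨ NP.+-monoʳ-≤ (length us) (NP.n≤1+n (length ws)) ⟩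
        length us N.+ length (b ∷ ws) ≡⟨ LP.length-++ us ⟨
        length (us ++ b ∷ ws)        ≤⟨ len ⟩
        fuel                         ∎
        where open NP.≤-Reasoning

toMonomial-lookup : ∀ {n m} (t : Term n m) v i →
  lookup (lookup (toMonomial t) v) i ≡ any (λ vi → (proj₁ vi == v) ∧ (proj₂ vi == i)) t
toMonomial-lookup t v i = trans (cong (λ row → lookup row i) (VP.lookup∘tabulate _ v)) (VP.lookup∘tabulate _ i)

∈⇒toMonomial : ∀ {n m} (t : Term n m) {v i} → (v , i) ∈ t → lookup (lookup (toMonomial t) v) i ≡ true
∈⇒toMonomial t {v} {i} vi∈t = trans (toMonomial-lookup t v i)
  (any-true⁺ (λ vi → (proj₁ vi == v) ∧ (proj₂ vi == i)) vi∈t (∧-true⁺ (≡⇒== {a = v} refl) (≡⇒== {a = i} refl)))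

toMonomial⇒∈ : ∀ {n m} (t : Term n m) v i → lookup (lookup (toMonomial t) v) i ≡ true → (v , i) ∈ t
toMonomial⇒∈ t v i e
  with (v′ , i′) , vi′∈t , match ← any-true⁻ (λ vi → (proj₁ vi == v) ∧ (proj₂ vi == i)) t
                                              (trans (sym (toMonomial-lookup t v i)) e)
  with refl ← ==⇒≡ {a = v′} (proj₁ (∧-true⁻ match))
  with refl ← ==⇒≡ {a = i′} (proj₂ (∧-true⁻ {v′ == v} match)) = vi′∈t

module Evaluation {n m} (f : Fin n → Fin m) where

  evalT : Term n m → Bool
  evalT t = and (map (λ vi → f (proj₁ vi) == proj₂ vi) t)

  evalP : Poly n m → Bool
  evalP p = ⊕ (map evalT p)

  evalT-true⁻ : ∀ {t} → evalT t ≡ true → ∀ {v i} → (v , i) ∈ t → f v ≡ i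
  evalT-true⁻ e vi∈t = ==⇒≡ (and-true⁻ (λ vi → f (proj₁ vi) == proj₂ vi) e vi∈t)

  evalT-true⁺ : ∀ t → (∀ {v i} → (v , i) ∈ t → f v ≡ i) → evalT t ≡ true
  evalT-true⁺ t h = and-true⁺ _ t (λ _ vi∈t → ≡⇒== (h vi∈t))

  evalT-resp-toMonomial : ∀ t t′ → toMonomial t ≡ toMonomial t′ → evalT t ≡ evalT t′
  evalT-resp-toMonomial t t′ same = ≡-from-true⇔ (transfer t t′ same) (transfer t′ t (sym same))
    where
    transfer : ∀ t t′ → toMonomial t ≡ toMonomial t′ → evalT t ≡ true → evalT t′ ≡ true
    transfer t t′ same e = evalT-true⁺ t′ λ {v} {i} vi∈t′ → evalT-true⁻ e
      (toMonomial⇒∈ t v i (trans (cong (λ M → lookup (lookup M v) i) same) (∈⇒toMonomial t′ vi∈t′)))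

  evalP-zero : ∀ p → (∀ M → coef p M ≡ false) → evalP p ≡ false
  evalP-zero = ⊕-evenMultiplicities (VP.≡-dec (VP.≡-dec B._≟_)) toMonomial evalT evalT-resp-toMonomial

  evalP-span : ∀ (𝒫 : Poly n m → Set) q → InSpan 𝒫 q → (∀ p → 𝒫 p → evalP p ≡ false) → evalP q ≡ false
  evalP-span 𝒫 q (ps , ps∈𝒫 , coef-q) vanish = begin
    evalP q                           ≡⟨ sym (xor-identityʳ _) ⟩
    evalP q xor false                 ≡⟨ cong (evalP q xor_) (sym (⊕-false (All.map (vanish _) ps∈𝒫))) ⟩
    evalP q xor ⊕ (map evalP ps)      ≡⟨ cong (evalP q xor_) (⊕-concat evalT ps) ⟨
    evalP q xor evalP (concat ps)     ≡⟨ ⊕-++ evalT q (concat ps) ⟨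
    evalP (q ++ concat ps)            ≡⟨ evalP-zero (q ++ concat ps) cancels ⟩
    false                             ∎
    where
    open ≡-Reasoning
    ⊕-false : ∀ {rs} → All (λ p → evalP p ≡ false) rs → ⊕ (map evalP rs) ≡ false
    ⊕-false []         = refl
    ⊕-false (e ∷ rest) rewrite e = ⊕-false rest
    cancels : ∀ M → coef (q ++ concat ps) M ≡ false
    cancels M = begin
      coef (q ++ concat ps) M          ≡⟨ ⊕-++ (occurs M) q (concat ps) ⟩
      coef q M xor coef (concat ps) M  ≡⟨ cong₂ _xor_ (coef-q M) (⊕-concat (occurs M) ps) ⟩
      ∑ps xor ∑ps                      ≡⟨ xor-same ∑ps ⟩
      false                            ∎
      where
      ∑ps = ⊕ (map (λ p → coef p M) ps)
      occurs : Monomial n m → Term n m → Bool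
      occurs M t = ⌊ VP.≡-dec (VP.≡-dec B._≟_) (toMonomial t) M ⌋

  evalT-tabulate⁺ : ∀ {k} (g : Fin k → Fin n × Fin m) → (∀ j → f (proj₁ (g j)) ≡ proj₂ (g j)) →
    evalT (toList (tabulate g)) ≡ true
  evalT-tabulate⁺ {N.zero}  g _ = refl
  evalT-tabulate⁺ {N.suc k} g h = ∧-true⁺ (≡⇒== (h zero)) (evalT-tabulate⁺ (g ∘ suc) (h ∘ suc))

  evalT-tabulate⁻ : ∀ {k} (g : Fin k → Fin n × Fin m) → evalT (toList (tabulate g)) ≡ true →
    ∀ j → f (proj₁ (g j)) ≡ proj₂ (g j)
  evalT-tabulate⁻ g e zero    = ==⇒≡ (proj₁ (∧-true⁻ e))
  evalT-tabulate⁻ g e (suc j) =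
    evalT-tabulate⁻ (g ∘ suc) (proj₂ (∧-true⁻ {f (proj₁ (g zero)) == proj₂ (g zero)} e)) j

  module Tuples {r} (s : Fin r → Fin n) where

    hits : Fin m → Bool
    hits y = ∑[ a < r ] (f (s a) == y)

    tupleTerm : ∀ {k} → Vec (Fin r) k → (Fin k → Fin m) → Term n m
    tupleTerm i x = toList (tabulate (λ j → s (lookup i j) , x j))

    -- Distributivity: the product of the sums  hits (x j)  is the sum over all tuples of indices.
    ⊕-allVecs : ∀ k (x : Fin k → Fin m) →
      ⊕ (map (λ i → evalT (tupleTerm i x)) (allVecs (allFin r) k)) ≡ ∏ (hits ∘ x)
    ⊕-allVecs N.zero    x = refl
    ⊕-allVecs (N.suc k) x = begin
      ⊕ (map val (concatMap (λ a → map (a ∷_) tuples) (allFin r)))  ≡⟨ ⊕-concatMap val _ (allFin r) ⟩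
      ⊕ (map (λ a → ⊕ (map val (map (a ∷_) tuples))) (allFin r))   ≡⟨ cong ⊕ (LP.map-cong first-index (allFin r)) ⟩
      ⊕ (map (λ a → hit a ∧ rest) (allFin r))                       ≡⟨ ⊕-∧ʳ hit rest (allFin r) ⟩
      ⊕ (map hit (allFin r)) ∧ rest                                  ≡⟨ cong (_∧ rest) (⊕-allFin hit) ⟩
      ∏ (hits ∘ x)                                                   ∎
      where
      open ≡-Reasoning
      tuples = allVecs (allFin r) k
      val : Vec (Fin r) (N.suc k) → Bool
      val i = evalT (tupleTerm i x)
      val′ : Vec (Fin r) k → Bool
      val′ i = evalT (tupleTerm i (x ∘ suc))
      hit : Fin r → Bool
      hit a = f (s a) == x zero
      rest = ∏ (hits ∘ x ∘ suc)
      first-index : ∀ a → ⊕ (map val (map (a ∷_) tuples)) ≡ hit a ∧ rest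
      first-index a = begin
        ⊕ (map val (map (a ∷_) tuples))          ≡⟨ cong ⊕ (LP.map-∘ tuples) ⟨
        ⊕ (map (λ i → hit a ∧ val′ i) tuples)    ≡⟨ ⊕-∧ˡ val′ (hit a) tuples ⟩
        hit a ∧ ⊕ (map val′ tuples)              ≡⟨ cong (hit a ∧_) (⊕-allVecs k (x ∘ suc)) ⟩
        hit a ∧ rest                             ∎

    distinct-if-evalT : ∀ {k} (i : Vec (Fin r) k) (x : Fin k → Fin m) → Injective x →
      evalT (tupleTerm i x) ≡ true → distinctB i ≡ true
    distinct-if-evalT i x x-inj e = distinctB⁺ i λ j j′ same →
      x-inj j j′ (trans (sym (evalT-tabulate⁻ _ e j)) (trans (cong (f ∘ s) same) (evalT-tabulate⁻ _ e j′)))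
      where
      ∉-toList : ∀ {k} a (w : Vec (Fin r) k) → (∀ j → ¬ a ≡ lookup w j) → any (a ==_) (toList w) ≡ false
      ∉-toList a []      _   = refl
      ∉-toList a (b ∷ w) a∉w rewrite ≢⇒== (a∉w zero) = ∉-toList a w (a∉w ∘ suc)
      distinctB⁺ : ∀ {k} (w : Vec (Fin r) k) → (∀ j j′ → lookup w j ≡ lookup w j′ → j ≡ j′) → distinctB w ≡ true
      distinctB⁺ []      _     = refl
      distinctB⁺ (a ∷ w) w-inj rewrite ∉-toList a w (λ j a≡ → FP.0≢1+n (w-inj zero (suc j) a≡)) =
        distinctB⁺ w (λ j j′ same → FP.suc-injective (w-inj (suc j) (suc j′) same))

  evalP-type1 : ∀ d (s : Fin (N.suc d) → Fin n) (x : Fin (N.suc d) → Fin m) → Injective x →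
    evalP (type1Poly d s x) ≡ ∏ (λ k → Tuples.hits s (x (inject₁ k)))
  evalP-type1 d s x x-inj = begin
    ⊕ (map evalT (map (λ i → tupleTerm i x′) distinct))  ≡⟨ cong ⊕ (LP.map-∘ distinct) ⟨
    ⊕ (map val distinct)                                 ≡⟨ ⊕-filter distinctB val tuples ⟩
    ⊕ (map (λ i → distinctB i ∧ val i) tuples)           ≡⟨ cong ⊕ (LP.map-cong drop-distinct tuples) ⟩
    ⊕ (map val tuples)                                   ≡⟨ ⊕-allVecs d x′ ⟩
    ∏ (hits ∘ x′)                                        ∎
    where
    open ≡-Reasoning
    open Tuples s
    x′ : Fin d → Fin m
    x′ k = x (inject₁ k)
    val : Vec (Fin (N.suc d)) d → Bool
    val i = evalT (tupleTerm i x′)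
    tuples = allVecs (allFin (N.suc d)) d
    distinct = filter (λ i → distinctB i B.≟ true) tuples
    drop-distinct : ∀ i → distinctB i ∧ val i ≡ val i
    drop-distinct i with val i in e
    ... | true  = cong (_∧ true) (distinct-if-evalT i x′ (λ a b → FP.inject₁-injective ∘ x-inj _ _) e)
    ... | false = ∧-zeroʳ (distinctB i)

-- Clique modules

IsColoring : ∀ {n m} → Graph n → Graph m → (Fin n → Fin m) → Set
IsColoring G H f = ∀ u v → adj G u v ≡ true → adj H (f u) (f v) ≡ true

openNbr⁺ : ∀ {n} (G : Graph n) (P : VSet n) {w v} → P w ≡ false → P v ≡ true → adj G w v ≡ true → openNbr G P w ≡ true
openNbr⁺ {n} G P {w} {v} Pw Pv wv rewrite Pw = any-true⁺ (λ v → P v ∧ adj G w v) (∈-allFin v) (∧-true⁺ Pv wv)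

openNbr⁻ : ∀ {n} (G : Graph n) (P : VSet n) {w} → openNbr G P w ≡ true →
  P w ≡ false × Σ (Fin n) λ v → P v ≡ true × adj G w v ≡ true
openNbr⁻ {n} G P {w} e with P w
... | false with v , _ , Pv∧wv ← any-true⁻ (λ v → P v ∧ adj G w v) (allFin n) e = refl , v , ∧-true⁻ Pv∧wv

record CliqueModule {n} (G : Graph n) (P : VSet n) : Set where
  field
    inside-adjacent    : ∀ u v → P u ≡ true → P v ≡ true → ¬ u ≡ v → adj G u v ≡ true
    neighbour-adjacent : ∀ u w → P u ≡ true → openNbr G P w ≡ true → adj G u w ≡ true

module Vanishing {m n} (H : Graph m) {G : Graph n} {P : VSet n} (P-module : CliqueModule G P)
                 {f : Fin n → Fin m} (f-col : IsColoring G H f) where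

  open CliqueModule P-module
  open Evaluation f

  colour-injectiveOn : InjectiveOn P f
  colour-injectiveOn u v Pu Pv fu≡fv with u F.≟ v
  ... | yes u≡v = u≡v
  ... | no  u≢v = contradiction (trans (sym loop) (irrefl H (f v))) (λ ())
    where
    loop : adj H (f v) (f v) ≡ true
    loop = subst (λ y → adj H y (f v) ≡ true) fu≡fv (f-col u v (inside-adjacent u v Pu Pv u≢v))

  -- Every x k is the colour of an odd number of the s a, and the degree bound at a vertex of P forces
  -- every colour f (s a) to be some x k; counting the pairs (a , k) with f (s a) = x k both ways
  -- then gives the parities of d and of d + 1.
  type1-vanishes : (s : Fin (N.suc (maxDegree H)) → Fin n) → (∀ a → openNbr G P (s a) ≡ true) →
    (x : Fin (N.suc (maxDegree H)) → Fin m) → Injective x → evalP (type1Poly (maxDegree H) s x) ≡ false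
  type1-vanishes s s∈N x x-inj with _ , v₀ , Pv₀ , _ ← openNbr⁻ G P (s∈N zero) = ¬-not λ evalTrue →
    not-¬ refl (count-twice (∏-true⁻ _ (trans (sym (evalP-type1 d s x x-inj)) evalTrue)))
    where
    open Tuples s
    d = maxDegree H
    x′ : Fin d → Fin m
    x′ k = x (inject₁ k)
    x′-inj : Injective x′
    x′-inj a b same = FP.inject₁-injective (x-inj _ _ same)
    s-colours : ∀ a → adj H (f v₀) (f (s a)) ≡ true
    s-colours a = f-col v₀ (s a) (neighbour-adjacent v₀ (s a) Pv₀ (s∈N a))
    count-twice : (∀ k → hits (x′ k) ≡ true) → ∑[ k < d ] true ≡ ∑[ a < N.suc d ] true
    count-twice odd = begin
      ∑[ k < d ] true                                  ≡⟨ sum-cong-≗ odd ⟨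
      ∑[ k < d ] ∑[ a < N.suc d ] (f (s a) == x′ k)    ≡⟨ ∑-comm (λ k a → f (s a) == x′ k) ⟩
      ∑[ a < N.suc d ] ∑[ k < d ] (f (s a) == x′ k)    ≡⟨ sum-cong-≗ exactly-one ⟩
      ∑[ a < N.suc d ] true                            ∎
      where
      open ≡-Reasoning
      x′-colours : ∀ k → adj H (f v₀) (x′ k) ≡ true
      x′-colours k with a , hit ← ∑-true⁻ _ (odd k) =
        subst (λ y → adj H (f v₀) y ≡ true) (==⇒≡ hit) (s-colours a)
      exactly-one : ∀ a → ∑[ k < d ] (f (s a) == x′ k) ≡ true
      exactly-one a with k , fsa≡ ← neighbourhood-covered H x′ x′-inj x′-colours (s-colours a) =
        ∑-indicator _ k (≡⇒== fsa≡) (λ k′ hit → x′-inj k′ k (trans (sym (==⇒≡ hit)) fsa≡))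

  type2-vanishes : ∀ {k} (s : Fin k → Fin n) → (∀ a → openNbr G P (s a) ≡ true) → (x : Fin k → Fin m) →
    cliqueNumber H (commonNbrs H x) < size P → evalP (toList (tabulate (λ a → s a , x a)) ∷ []) ≡ false
  type2-vanishes s s∈N x ω<size = ¬-not λ evalTrue → NP.<⇒≱ ω<size (begin
    size P                           ≤⟨ ≤-size-image f P colour-injectiveOn ⟩
    size (image f P)                 ≤⟨ clique⇒≤cliqueNumber H (image⊆common (coloured evalTrue)) image-clique ⟩
    cliqueNumber H (commonNbrs H x)  ∎)
    where
    open NP.≤-Reasoning
    coloured : evalP (toList (tabulate (λ a → s a , x a)) ∷ []) ≡ true → ∀ a → f (s a) ≡ x a
    coloured e = evalT-tabulate⁻ _ (trans (sym (xor-identityʳ _)) e)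
    image⊆common : (∀ a → f (s a) ≡ x a) → image f P ⊆ commonNbrs H x
    image⊆common fs≡x y y∈ with v , Pv , refl ← image⁻ f P y∈ = commonNbrs⁺ H x λ a →
      subst (λ z → adj H z (f v) ≡ true) (fs≡x a)
        (f-col (s a) v (trans (adj-sym G (s a) v) (neighbour-adjacent v (s a) Pv (s∈N a))))
    image-clique : IsClique H (image f P)
    image-clique y y′ y∈ y′∈ y≢y′ with u , Pu , refl ← image⁻ f P y∈ | v , Pv , refl ← image⁻ f P y′∈ =
      f-col u v (inside-adjacent u v Pu Pv (λ u≡v → y≢y′ (cong f u≡v)))

  L-vanishes : ∀ {q} → L H P G q → evalP q ≡ false
  L-vanishes (type1 s _ s∈N x x-inj)        = type1-vanishes s s∈N x x-inj
  L-vanishes (type2 _ _ _ s _ s∈N x ω<size) = type2-vanishes s s∈N x ω<size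

twins-adjacent : ∀ {n} (G : Graph n) {u v} → Twins G u v → ¬ u ≡ v → adj G u v ≡ true
twins-adjacent G {u} {v} twins u≢v =
  trans (cong (_∨ adj G u v) (sym (≢⇒== u≢v))) (trans (twins v) (cong (_∨ adj G v v) (≡⇒== {a = v} refl)))

twins-adj : ∀ {n} (G : Graph n) {u v w} → Twins G u v → ¬ u ≡ w → ¬ v ≡ w → adj G u w ≡ adj G v w
twins-adj G {u} {v} {w} twins u≢w v≢w =
  trans (cong (_∨ adj G u w) (sym (≢⇒== u≢w))) (trans (twins w) (cong (_∨ adj G v w) (≢⇒== v≢w)))

crossing-resp : ∀ {n} (X Y : VSet n) {u v w} → X u ≡ X v → Y u ≡ Y v → crossing X Y u w ≡ crossing X Y v w
crossing-resp X Y {w = w} Xu≡Xv Yu≡Yv = cong₂ (λ a b → (a ∧ Y w) ∨ (b ∧ X w)) Xu≡Xv Yu≡Yv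

module _ {n k} {G : Graph n} {π : Fin n → Fin k} where

  twinPart-cliqueModule : IsTwinDecomposition G π → ∀ j → CliqueModule G (part π j)
  twinPart-cliqueModule (_ , twin⇔) j = record
    { inside-adjacent    = λ u v Pu Pv → twins-adjacent G (twins Pu Pv)
    ; neighbour-adjacent = neighbour-adjacent
    }
    where
    twins : ∀ {u v} → part π j u ≡ true → part π j v ≡ true → Twins G u v
    twins {u} {v} Pu Pv = Equivalence.to (twin⇔ u v) (trans (==⇒≡ Pu) (sym (==⇒≡ Pv)))
    neighbour-adjacent : ∀ u w → part π j u ≡ true → openNbr G (part π j) w ≡ true → adj G u w ≡ true
    neighbour-adjacent u w Pu w∈N with Pw , v , Pv , wv ← openNbr⁻ G (part π j) w∈N =
      trans (twins-adj G (twins Pu Pv) (outside Pu) (outside Pv)) (trans (adj-sym G v w) wv)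
      where
      outside : ∀ {x} → part π j x ≡ true → ¬ x ≡ w
      outside Px refl = contradiction (trans (sym Px) Pw) (λ ())

  module _ {P′ P″ : Fin k} (P′≢P″ : ¬ P′ ≡ P″) where

    crossing-inside : ∀ {u v} → π u ≡ π v → crossing (part π P′) (part π P″) u v ≡ false
    crossing-inside {u} {v} same rewrite sym same with π u == P′ in u∈P′ | π u == P″ in u∈P″
    ... | true  | true  = contradiction (trans (sym (==⇒≡ u∈P′)) (==⇒≡ u∈P″)) P′≢P″
    ... | true  | false = refl
    ... | false | b     = ∧-zeroʳ b

    removeEdges-cliqueModule : ∀ {j} → CliqueModule G (part π j) →
      CliqueModule (removeEdges G (part π P′) (part π P″)) (part π j)
    removeEdges-cliqueModule {j} P-module = record
      { inside-adjacent    = λ u v Pu Pv u≢v →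
          cong₂ (λ e c → e ∧ not c) (inside-adjacent u v Pu Pv u≢v) (crossing-inside (same-part Pu Pv))
      ; neighbour-adjacent = neighbour-adjacent′
      }
      where
      open CliqueModule P-module
      A = part π P′
      B = part π P″
      G′ = removeEdges G A B
      same-part : ∀ {u v} → part π j u ≡ true → part π j v ≡ true → π u ≡ π v
      same-part Pu Pv = trans (==⇒≡ Pu) (sym (==⇒≡ Pv))
      neighbour-adjacent′ : ∀ u w → part π j u ≡ true → openNbr G′ (part π j) w ≡ true → adj G′ u w ≡ true
      neighbour-adjacent′ u w Pu w∈N′ with Pw , v , Pv , wv′ ← openNbr⁻ G′ (part π j) w∈N′ =
        ∧-true⁺ (neighbour-adjacent u w Pu (openNbr⁺ G (part π j) Pw Pv (proj₁ (∧-true⁻ wv′))))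
                (trans (cong not (crossing-resp A B (cong (_== P′) u≈v) (cong (_== P″) u≈v)))
                       (proj₂ (∧-true⁻ {adj G v w} (trans (adj-sym G′ v w) wv′))))
        where
        u≈v = same-part Pu Pv

removeEdges-outside : ∀ {n} (G : Graph n) (X Y : VSet n) {u v} → X u ≡ false → X v ≡ false →
  adj G u v ≡ true → adj (removeEdges G X Y) u v ≡ true
removeEdges-outside G X Y {u} {v} Xu Xv uv = cong₂ (λ e c → e ∧ not c) uv no-crossing
  where
  no-crossing : crossing X Y u v ≡ false
  no-crossing rewrite Xu | Xv = ∧-zeroʳ (Y u)

colorable-removeEdges : ∀ {n m} (G : Graph n) (H : Graph m) (X Y : VSet n) →
  Colorable G H → Colorable (removeEdges G X Y) H
colorable-removeEdges G H X Y (f , f-col) = f , λ u v uv′ → f-col u v (proj₁ (∧-true⁻ uv′))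

-- Recolouring

extendInjectively : ∀ {n m} (P : VSet n) (Q : VSet m) → size P ≤ size Q → (f : Fin n → Fin m) →
  Σ (Fin n → Fin m) λ g →
    (∀ v → P v ≡ false → g v ≡ f v) × (∀ v → P v ≡ true → Q (g v) ≡ true) × InjectiveOn P g
extendInjectively {n} {m} P Q P≤Q f = g , g-outside , g-inside , g-injective
  where
  module EP = Enumeration P
  module EQ = Enumeration Q
  g : Fin n → Fin m
  g v with FP.any? (λ i → EP.enum i F.≟ v)
  ... | yes (i , _) = EQ.enum (inject≤ i P≤Q)
  ... | no _        = f v
  g-outside : ∀ v → P v ≡ false → g v ≡ f v
  g-outside v Pv with FP.any? (λ i → EP.enum i F.≟ v)
  ... | yes (i , refl) = contradiction (trans (sym (EP.enum-∈ i)) Pv) (λ ())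
  ... | no _           = refl
  g-onto : ∀ v → P v ≡ true → Σ (Fin (size P)) λ i → EP.enum i ≡ v × g v ≡ EQ.enum (inject≤ i P≤Q)
  g-onto v Pv with FP.any? (λ i → EP.enum i F.≟ v)
  ... | yes (i , enum≡v) = i , enum≡v , refl
  ... | no none          = contradiction (EP.enum-surjective v Pv) none
  g-inside : ∀ v → P v ≡ true → Q (g v) ≡ true
  g-inside v Pv with _ , _ , gv≡ ← g-onto v Pv = subst (λ y → Q y ≡ true) (sym gv≡) (EQ.enum-∈ _)
  g-injective : InjectiveOn P g
  g-injective u v Pu Pv gu≡gv with i , refl , gu≡ ← g-onto u Pu | j , refl , gv≡ ← g-onto v Pv =
    cong EP.enum (FP.inject≤-injective P≤Q P≤Q i j (EQ.enum-injective _ _ (trans (sym gu≡) (trans gu≡gv gv≡))))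

recolouring-isColoring : ∀ {n m} (G : Graph n) (H : Graph m) (A : VSet n) (f g : Fin n → Fin m) →
  (∀ v → A v ≡ false → g v ≡ f v) →
  (∀ u v → A u ≡ false → A v ≡ false → adj G u v ≡ true → adj H (f u) (f v) ≡ true) →
  (∀ u v → A u ≡ true → A v ≡ true → ¬ u ≡ v → adj H (g u) (g v) ≡ true) →
  (∀ u w → A u ≡ true → openNbr G A w ≡ true → adj H (g u) (f w) ≡ true) →
  IsColoring G H g
recolouring-isColoring G H A f g agree outside inside boundary u v uv with A u in Au | A v in Av
... | true  | true  = inside u v Au Av λ { refl → contradiction (trans (sym uv) (irrefl G u)) (λ ()) }
... | true  | false = subst (λ y → adj H (g u) y ≡ true) (sym (agree v Av))
                        (boundary u v Au (openNbr⁺ G A Av Au (trans (adj-sym G v u) uv)))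
... | false | true  = subst (λ y → adj H y (g v) ≡ true) (sym (agree u Au))
                        (trans (adj-sym H (f u) (g v)) (boundary v u Av (openNbr⁺ G A Au Av uv)))
... | false | false = subst₂ (λ y z → adj H y z ≡ true) (sym (agree u Au)) (sym (agree v Av)) (outside u v Au Av uv)

module NeighbourColours {m n} (H : Graph m) (G : Graph n) (A : VSet n) (f : Fin n → Fin m)
                        (vanish : ∀ {q} → L H A G q → Evaluation.evalP f q ≡ false) where

  open Evaluation f

  Y : VSet m
  Y = image f (openNbr G A)

  open Enumeration Y
    renaming (enum to colour; enum-injective to colour-injective; enum-surjective to colour-surjective)

  representative : Fin (size Y) → Fin n
  representative a = proj₁ (image⁻ f (openNbr G A) (enum-∈ a))

  representative-∈ : ∀ a → openNbr G A (representative a) ≡ true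
  representative-∈ a = proj₁ (proj₂ (image⁻ f (openNbr G A) (enum-∈ a)))

  representative-colour : ∀ a → f (representative a) ≡ colour a
  representative-colour a = proj₂ (proj₂ (image⁻ f (openNbr G A) (enum-∈ a)))

  representative-injective : Injective representative
  representative-injective a b same =
    colour-injective a b (trans (sym (representative-colour a)) (trans (cong f same) (representative-colour b)))

  module _ (d<size : maxDegree H < size Y) where

    private
      d = maxDegree H
      s : Fin (N.suc d) → Fin n
      s a = representative (inject≤ a d<size)
      x : Fin (N.suc d) → Fin m
      x a = colour (inject≤ a d<size)
      s-injective : Injective s
      s-injective a b same = FP.inject≤-injective d<size d<size a b (representative-injective _ _ same)
      x-injective : Injective x
      x-injective a b same = FP.inject≤-injective d<size d<size a b (colour-injective _ _ same)
      evalTrue : evalP (type1Poly d s x) ≡ true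
      evalTrue = trans (evalP-type1 d s x x-injective) (∏-true⁺ _ λ k →
        ∑-indicator _ (inject₁ k) (≡⇒== (representative-colour _))
          (λ a hit → x-injective a (inject₁ k) (trans (sym (representative-colour _)) (==⇒≡ hit))))

    maxDegree≮size : ⊥
    maxDegree≮size =
      contradiction (trans (sym (vanish (type1 s s-injective (representative-∈ ∘ _) x x-injective))) evalTrue) (λ ())

  size≤maxDegree : size Y ≤ maxDegree H
  size≤maxDegree = NP.≮⇒≥ maxDegree≮size

  size≤cliqueNumber : 1 ≤ size Y → size A ≤ cliqueNumber H (commonNbrs H colour)
  size≤cliqueNumber 1≤size = NP.≮⇒≥ λ ω<size →
    contradiction (trans (sym (vanish (type2 _ 1≤size size≤maxDegree representative representative-injective
                                                representative-∈ colour ω<size)))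
                         (cong (_xor false) (evalT-tabulate⁺ _ representative-colour)))
                  (λ ())

  colorable : (∀ u v → A u ≡ false → A v ≡ false → adj G u v ≡ true → adj H (f u) (f v) ≡ true) →
    ∀ {u₀ w₀} → A u₀ ≡ true → openNbr G A w₀ ≡ true → Colorable G H
  colorable outside Au₀ w₀∈N
    with C , C⊆common , C-clique , A≤C ← cliqueNumber-witness H (commonNbrs H colour) (nonempty⇒1≤size A Au₀)
                                           (size≤cliqueNumber (nonempty⇒1≤size Y (image⁺ f (openNbr G A) w₀∈N)))
    with g , agree , g∈C , g-injective ← extendInjectively A C A≤C f
    = g , recolouring-isColoring G H A f g agree outside inside boundary
    where
    inside : ∀ u v → A u ≡ true → A v ≡ true → ¬ u ≡ v → adj H (g u) (g v) ≡ true
    inside u v Au Av u≢v = C-clique (g u) (g v) (g∈C u Au) (g∈C v Av) (u≢v ∘ g-injective u v Au Av)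
    boundary : ∀ u w → A u ≡ true → openNbr G A w ≡ true → adj H (g u) (f w) ≡ true
    boundary u w Au w∈N with a , colour≡fw ← colour-surjective (f w) (image⁺ f (openNbr G A) w∈N) =
      subst (λ y → adj H (g u) y ≡ true) colour≡fw
        (trans (adj-sym H (g u) (colour a)) (commonNbrs⁻ H colour (C⊆common (g u) (g∈C u Au)) a))

lemma18 : ∀ {m n k} (H : Graph m) (G : Graph n) (π : Fin n → Fin k) →
    IsTwinDecomposition G π →
    (P′ P″ : Fin k) → ¬ (P′ ≡ P″) →
    HasCrossingEdge G (part π P′) (part π P″) →
    SubSpan (L H (part π P′) G) (LΠ H π (removeEdges G (part π P′) (part π P″))) →
    Colorable G H ⇔ Colorable (removeEdges G (part π P′) (part π P″)) H
lemma18 H G π twins P′ P″ P′≢P″ (u₀ , v₀ , u₀∈P′ , v₀∈P″ , u₀v₀) span =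
  mk⇔ (colorable-removeEdges G H A B) λ (f , f-col) →
    NeighbourColours.colorable H G A f (vanish f-col)
      (λ u v Au Av uv → f-col u v (removeEdges-outside G A B Au Av uv)) u₀∈P′ v₀∈N
  where
  A = part π P′
  B = part π P″
  G′ = removeEdges G A B
  vanish : ∀ {f} → IsColoring G′ H f → ∀ {q} → L H A G q → Evaluation.evalP f q ≡ false
  vanish {f} f-col {q} q∈L = Evaluation.evalP-span f _ q (span q q∈L) λ p (j , p∈L) →
    Vanishing.L-vanishes H (removeEdges-cliqueModule P′≢P″ (twinPart-cliqueModule twins j)) f-col p∈L
  v₀∈N : openNbr G A v₀ ≡ true
  v₀∈N = openNbr⁺ G A (≢⇒== λ π≡P′ → P′≢P″ (trans (sym π≡P′) (==⇒≡ v₀∈P″)))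
                       u₀∈P′ (trans (adj-sym G v₀ u₀) u₀v₀)
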